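{- For every graph $G$ and every integer $d \ge 2$, $\Gamma_d(G,d) = \alpha(G)$.
   Context: $\alpha(G)$ is the independence number of $G$. In a digraph $D$, $d_D(u,v)$ is the length of a shortest directed path from $u$ to $v$. A directed $d$-distance dominating set of $D$ is a set $U \subseteq V(D)$ such that every $v \notin U$ has some $u \in U$ with $d_D(u,v) \le d$; $\gamma(D,d)$ is the minimum size of such a set. For a graph $G$, $\Gamma_d(G,d) = \max\{\gamma(D,d) : D \text{ an orientation of } G\}$. -}

module Defs where

open import Data.Nat using (ℕ; zero; suc; _≤_)
open import Data.Bool using (Bool; true; false)
open import Data.Fin using (Fin)
open import Data.Fin.Subset using (Subset; _∈_; _∉_; ∣_∣)
open import Data.Product using (Σ; ∃; ∃-syntax; _×_; _,_)
open import Data.Sum using (_⊎_)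
open import Relation.Binary.PropositionalEquality using (_≡_)

record Graph (n : ℕ) : Set where
  field
    adj    : Fin n → Fin n → Bool
    sym    : ∀ u v → adj u v ≡ adj v u
    irrefl : ∀ v → adj v v ≡ false
open Graph public

Digraph : ℕ → Set
Digraph n = Fin n → Fin n → Bool

IsOrientation : ∀ {n} → Graph n → Digraph n → Set
IsOrientation {n} G D =
  (∀ u v → D u v ≡ true → adj G u v ≡ true) ×
  (∀ u v → adj G u v ≡ true → D u v ≡ true ⊎ D v u ≡ true) ×
  (∀ u v → D u v ≡ true → D v u ≡ false)

data Walk {n : ℕ} (D : Digraph n) : ℕ → Fin n → Fin n → Set where
  here : ∀ {u} → Walk D zero u u
  step : ∀ {k u w v} → D u w ≡ true → Walk D k w v → Walk D (suc k) u v

-- d_D(u,v) ≤ d : there is a directed walk (equivalently a path) of length ≤ d.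
DistLe : ∀ {n} → Digraph n → Fin n → Fin n → ℕ → Set
DistLe D u v d = ∃[ k ] (k ≤ d × Walk D k u v)

IsDistDominating : ∀ {n} → Digraph n → ℕ → Subset n → Set
IsDistDominating {n} D d U =
  ∀ (v : Fin n) → v ∉ U → ∃[ u ] (u ∈ U × DistLe D u v d)

IsDomNumber : ∀ {n} → Digraph n → ℕ → ℕ → Set
IsDomNumber {n} D d g =
  (∃[ U ] (IsDistDominating D d U × ∣ U ∣ ≡ g)) ×
  (∀ (U : Subset n) → IsDistDominating D d U → g ≤ ∣ U ∣)

IsOrientedDomNumber : ∀ {n} → Graph n → ℕ → ℕ → Set
IsOrientedDomNumber {n} G d m =
  (∃[ D ] (IsOrientation G D × IsDomNumber D d m)) ×
  (∀ (D : Digraph n) → IsOrientation G D → ∀ g → IsDomNumber D d g → g ≤ m)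

IsIndependent : ∀ {n} → Graph n → Subset n → Set
IsIndependent G U = ∀ u v → u ∈ U → v ∈ U → adj G u v ≡ false

IsIndependenceNumber : ∀ {n} → Graph n → ℕ → Set
IsIndependenceNumber {n} G a =
  (∃[ U ] (IsIndependent G U × ∣ U ∣ ≡ a)) ×
  (∀ (U : Subset n) → IsIndependent G U → ∣ U ∣ ≤ a)

-- Lower bound: orient every edge out of a maximum independent set I (and the remaining
-- edges acyclically); the vertices of I are then sources, so every dominating set
-- contains I.  Upper bound: by the Chvátal–Lovász argument every digraph has an
-- independent set from which every vertex is reachable within two steps; for an
-- orientation of G it is independent in G, hence has at most α(G) vertices, and it
-- d-dominates because d ≥ 2.
module Submission where

open import Defs
open import Data.Nat using (ℕ; zero; suc; _+_; _≤_; _<_; _<ᵇ_; z≤n; s≤s)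
open import Data.Nat.Properties
  using (≤-refl; ≤-trans; <ᵇ⇒<; <⇒<ᵇ; ≤-antisym; <-asym; <-cmp; <⇒≢; <-≤-trans; m≤m+n; +-cancelˡ-≡)
open import Data.Bool using (true; false; _∧_)
open import Data.Bool.Properties using (¬-not; T-≡) renaming (_≟_ to _≟ᵇ_)
open import Data.Fin using (Fin; toℕ) renaming (_≟_ to _≟ᶠ_)
open import Data.Fin.Properties using (toℕ-injective; toℕ<n; any?)
open import Data.Fin.Subset using (Subset; _∈_; _∉_; ∣_∣; _⊆_; _∪_; ⁅_⁆) renaming (⊥ to ∅)
open import Data.Fin.Subset.Properties
  using (_∈?_; x∈⁅x⁆; x∈⁅y⁆⇒x≡y; x∈p∪q⁻; x∈p∪q⁺; p⊆q⇒∣p∣≤∣q∣) renaming (∉⊥ to ∉∅)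
open import Data.List using (List; []; _∷_; length; filter; allFin)
open import Data.List.Properties using (length-filter)
open import Data.List.Membership.Propositional using () renaming (_∈_ to _∈ˡ_)
open import Data.List.Membership.Propositional.Properties using (∈-filter⁺; ∈-filter⁻; ∈-allFin)
open import Data.List.Relation.Unary.Any using (here; there)
open import Data.Empty using (⊥; ⊥-elim)
open import Data.Product using (∃-syntax; _×_; _,_; proj₁; proj₂)
open import Data.Sum using (_⊎_; inj₁; inj₂)
open import Function using (Injective; _∘_; Equivalence)
open import Relation.Nullary using (¬_; yes; no; ¬?)
open import Relation.Nullary.Decidable using (_×-dec_)
open import Relation.Unary using (Decidable)
open import Relation.Binary.Definitions using (tri<; tri≈; tri>)
open import Relation.Binary.PropositionalEquality using (_≡_; _≢_; refl; trans; subst)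
  renaming (sym to ≡-sym)

≡false⇒≢true : ∀ {b} → b ≡ false → b ≢ true
≡false⇒≢true refl ()

∧≡true⁻ : ∀ {a b} → a ∧ b ≡ true → a ≡ true × b ≡ true
∧≡true⁻ {true} {true} refl = refl , refl

adj⇒≢ : ∀ {n} (G : Graph n) {u v} → adj G u v ≡ true → u ≢ v
adj⇒≢ G {u} e refl = ≡false⇒≢true (irrefl G u) e

module _ {n : ℕ} {D : Digraph n} where

  DistLe-mono : ∀ {u v d d′} → d ≤ d′ → DistLe D u v d → DistLe D u v d′
  DistLe-mono d≤d′ (k , k≤d , w) = k , ≤-trans k≤d d≤d′ , w

  IsDistDominating-mono : ∀ {d d′ U} → d ≤ d′ → IsDistDominating D d U → IsDistDominating D d′ U
  IsDistDominating-mono d≤d′ dom v v∉U with dom v v∉U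
  ... | u , u∈U , dist = u , u∈U , DistLe-mono d≤d′ dist

  walk-lastArc : ∀ {k u v} → Walk D (suc k) u v → ∃[ x ] (D x v ≡ true)
  walk-lastArc (step {u = u} e here)  = u , e
  walk-lastArc (step _ w@(step _ _)) = walk-lastArc w

  source∈dominating : ∀ {d U x} → (∀ y → D y x ≡ false) → IsDistDominating D d U → x ∈ U
  source∈dominating {U = U} {x} source dom with x ∈? U
  ... | yes x∈U = x∈U
  ... | no x∉U with dom x x∉U
  ... | u , u∈U , zero , _ , here = u∈U
  ... | _ , _ , suc _ , _ , w = let y , e = walk-lastArc w in ⊥-elim (≡false⇒≢true (source y) e)

-- A quasi-kernel of the reverse of D in the sense of Chvátal–Lovász, relative to the
-- vertex list R.
record IsQuasiKernel {n : ℕ} (D : Digraph n) (R : List (Fin n)) (S : Subset n) : Set where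
  field
    ⊆R          : ∀ {u} → u ∈ S → u ∈ˡ R
    independent : ∀ {u v} → u ∈ S → v ∈ S → D u v ≡ false
    absorbing   : ∀ {w} → w ∈ˡ R → w ∈ S ⊎ ∃[ u ] (u ∈ S × DistLe D u w 2)

module QuasiKernel {n : ℕ} (D : Digraph n) (loopless : ∀ v → D v v ≡ false) where

  _∉N⁺[_] : Fin n → Fin n → Set
  w ∉N⁺[ v ] = w ≢ v × D v w ≡ false

  ∉N⁺?[_] : ∀ v → Decidable (_∉N⁺[ v ])
  ∉N⁺?[ v ] w = ¬? (w ≟ᶠ v) ×-dec (D v w ≟ᵇ false)

  ∈N⁺[_] : ∀ v {w} → ¬ w ∉N⁺[ v ] → w ≡ v ⊎ D v w ≡ true
  ∈N⁺[ v ] {w} w∈ with w ≟ᶠ v | D v w ≟ᵇ true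
  ... | yes w≡v | _        = inj₁ w≡v
  ... | no _    | yes e    = inj₂ e
  ... | no w≢v  | no D≢true = ⊥-elim (w∈ (w≢v , ¬-not D≢true))

  residue : Fin n → List (Fin n) → List (Fin n)
  residue v = filter ∉N⁺?[ v ]

  arc-dist : ∀ {u w} → D u w ≡ true → DistLe D u w 2
  arc-dist e = 1 , s≤s z≤n , step e here

  -- The Chvátal–Lovász step: a quasi-kernel of the residue either reaches v in one
  -- step, and then all of N⁺[v] within two, or it can be extended by v.
  keep : ∀ {v rest S s} → IsQuasiKernel D (residue v rest) S →
         s ∈ S → D s v ≡ true → IsQuasiKernel D (v ∷ rest) S
  keep {v} {rest} {S} {s} qk s∈S sv = record
    { ⊆R          = there ∘ proj₁ ∘ ∈-filter⁻ ∉N⁺?[ v ] ∘ ⊆R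
    ; independent = independent
    ; absorbing   = absorbing′
    }
    where
    open IsQuasiKernel qk
    absorbing′ : ∀ {w} → w ∈ˡ v ∷ rest → w ∈ S ⊎ ∃[ u ] (u ∈ S × DistLe D u w 2)
    absorbing′ (here refl) = inj₂ (s , s∈S , arc-dist sv)
    absorbing′ {w} (there w∈) with ∉N⁺?[ v ] w
    ... | yes w∉N⁺ = absorbing (∈-filter⁺ ∉N⁺?[ v ] w∈ w∉N⁺)
    ... | no w∈N⁺ with ∈N⁺[ v ] w∈N⁺
    ... | inj₁ refl = inj₂ (s , s∈S , arc-dist sv)
    ... | inj₂ vw   = inj₂ (s , s∈S , 2 , ≤-refl , step sv (step vw here))

  add : ∀ {v rest S} → IsQuasiKernel D (residue v rest) S →
        (∀ {s} → s ∈ S → D s v ≡ false) → IsQuasiKernel D (v ∷ rest) (⁅ v ⁆ ∪ S)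
  add {v} {rest} {S} qk ∄sv = record
    { ⊆R          = ⊆R′
    ; independent = independent′
    ; absorbing   = absorbing′
    }
    where
    open IsQuasiKernel qk
    ∈-insert⁻ : ∀ {u} → u ∈ ⁅ v ⁆ ∪ S → u ≡ v ⊎ u ∈ S
    ∈-insert⁻ u∈ with x∈p∪q⁻ ⁅ v ⁆ S u∈
    ... | inj₁ u∈v = inj₁ (x∈⁅y⁆⇒x≡y v u∈v)
    ... | inj₂ u∈S = inj₂ u∈S
    S⊆residue : ∀ {u} → u ∈ S → u ∈ˡ rest × u ∉N⁺[ v ]
    S⊆residue = ∈-filter⁻ ∉N⁺?[ v ] ∘ ⊆R
    ⊆R′ : ∀ {u} → u ∈ ⁅ v ⁆ ∪ S → u ∈ˡ v ∷ rest
    ⊆R′ u∈ with ∈-insert⁻ u∈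
    ... | inj₁ u≡v = here u≡v
    ... | inj₂ u∈S = there (proj₁ (S⊆residue u∈S))
    independent′ : ∀ {a b} → a ∈ ⁅ v ⁆ ∪ S → b ∈ ⁅ v ⁆ ∪ S → D a b ≡ false
    independent′ a∈ b∈ with ∈-insert⁻ a∈ | ∈-insert⁻ b∈
    ... | inj₁ refl | inj₁ refl = loopless v
    ... | inj₁ refl | inj₂ b∈S  = proj₂ (proj₂ (S⊆residue b∈S))
    ... | inj₂ a∈S  | inj₁ refl = ∄sv a∈S
    ... | inj₂ a∈S  | inj₂ b∈S  = independent a∈S b∈S
    v∈ : v ∈ ⁅ v ⁆ ∪ S
    v∈ = x∈p∪q⁺ (inj₁ (x∈⁅x⁆ v))
    absorbing′ : ∀ {w} → w ∈ˡ v ∷ rest → w ∈ ⁅ v ⁆ ∪ S ⊎ ∃[ u ] (u ∈ ⁅ v ⁆ ∪ S × DistLe D u w 2)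
    absorbing′ (here refl) = inj₁ v∈
    absorbing′ {w} (there w∈) with ∉N⁺?[ v ] w
    ... | no w∈N⁺ with ∈N⁺[ v ] w∈N⁺
    ...   | inj₁ refl = inj₁ v∈
    ...   | inj₂ vw   = inj₂ (v , v∈ , arc-dist vw)
    absorbing′ {w} (there w∈) | yes w∉N⁺ with absorbing (∈-filter⁺ ∉N⁺?[ v ] w∈ w∉N⁺)
    ... | inj₁ w∈S              = inj₁ (x∈p∪q⁺ (inj₂ w∈S))
    ... | inj₂ (u , u∈S , dist) = inj₂ (u , x∈p∪q⁺ (inj₂ u∈S) , dist)

  -- Recursion on a fuel bound, since the residue is not a structural sublist.
  quasiKernel-≤ : ∀ fuel (R : List (Fin n)) → length R ≤ fuel → ∃[ S ] IsQuasiKernel D R S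
  quasiKernel-≤ _ [] _ = ∅ , record
    { ⊆R          = ⊥-elim ∘ ∉∅
    ; independent = ⊥-elim ∘ ∉∅
    ; absorbing   = λ ()
    }
  quasiKernel-≤ (suc fuel) (v ∷ rest) (s≤s |rest|≤fuel)
    with S , qk ← quasiKernel-≤ fuel (residue v rest) (≤-trans (length-filter ∉N⁺?[ v ] rest) |rest|≤fuel)
    with any? (λ s → s ∈? S ×-dec D s v ≟ᵇ true)
  ... | yes (s , s∈S , sv) = S , keep qk s∈S sv
  ... | no ∄sv = ⁅ v ⁆ ∪ S , add qk (λ {s} s∈S → ¬-not (λ sv → ∄sv (s , s∈S , sv)))

  quasiKernel : ∀ R → ∃[ S ] IsQuasiKernel D R S
  quasiKernel R = quasiKernel-≤ (length R) R ≤-refl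

orientation-loopless : ∀ {n} (G : Graph n) {D : Digraph n} → IsOrientation G D → ∀ v → D v v ≡ false
orientation-loopless G (arc⇒adj , _) v = ¬-not λ e → adj⇒≢ G (arc⇒adj v v e) refl

orientation-independentDominating : ∀ {n} (G : Graph n) {D : Digraph n} {d} →
  IsOrientation G D → 2 ≤ d → ∃[ U ] (IsDistDominating D d U × IsIndependent G U)
orientation-independentDominating {n} G {D} o@(_ , adj⇒arc , _) 2≤d
  with S , qk ← QuasiKernel.quasiKernel D (orientation-loopless G o) (allFin n)
  = S , IsDistDominating-mono 2≤d dominating , independentG
  where
  open IsQuasiKernel qk
  dominating : IsDistDominating D 2 S
  dominating v v∉S with absorbing (∈-allFin v)
  ... | inj₁ v∈S = ⊥-elim (v∉S v∈S)
  ... | inj₂ near = near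
  independentG : IsIndependent G S
  independentG u v u∈S v∈S = ¬-not λ e → case-arc (adj⇒arc u v e)
    where
    case-arc : D u v ≡ true ⊎ D v u ≡ true → ⊥
    case-arc (inj₁ uv) = ≡false⇒≢true (independent u∈S v∈S) uv
    case-arc (inj₂ vu) = ≡false⇒≢true (independent v∈S u∈S) vu

module RankOrientation {n : ℕ} (G : Graph n) (r : Fin n → ℕ) where

  orientByRank : Digraph n
  orientByRank u v = adj G u v ∧ (r u <ᵇ r v)

  arc-intro : ∀ {u v} → adj G u v ≡ true → r u < r v → orientByRank u v ≡ true
  arc-intro e lt rewrite e = Equivalence.to T-≡ (<⇒<ᵇ lt)

  arc-elim : ∀ {u v} → orientByRank u v ≡ true → adj G u v ≡ true × r u < r v
  arc-elim {u} {v} e = let a , lt = ∧≡true⁻ e in a , <ᵇ⇒< (r u) (r v) (Equivalence.from T-≡ lt)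

  isOrientation : Injective _≡_ _≡_ r → IsOrientation G orientByRank
  isOrientation r-inj = (λ _ _ → proj₁ ∘ arc-elim) , adj⇒arc , asymmetric
    where
    adj⇒arc : ∀ u v → adj G u v ≡ true → orientByRank u v ≡ true ⊎ orientByRank v u ≡ true
    adj⇒arc u v e with <-cmp (r u) (r v)
    ... | tri< lt _ _ = inj₁ (arc-intro e lt)
    ... | tri≈ _ eq _ = ⊥-elim (adj⇒≢ G e (r-inj eq))
    ... | tri> _ _ gt = inj₂ (arc-intro (trans (≡-sym (Graph.sym G u v)) e) gt)
    asymmetric : ∀ u v → orientByRank u v ≡ true → orientByRank v u ≡ false
    asymmetric u v e = ¬-not λ e′ → <-asym (proj₂ (arc-elim e)) (proj₂ (arc-elim e′))

  source : ∀ {x} → (∀ {w} → adj G w x ≡ true → r x < r w) → ∀ y → orientByRank y x ≡ false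
  source below y = ¬-not λ e → let a , lt = arc-elim e in <-asym lt (below a)

module _ {n : ℕ} (I : Subset n) where

  insideFirst : Fin n → ℕ
  insideFirst v with v ∈? I
  ... | yes _ = toℕ v
  ... | no _  = n + toℕ v

  private
    toℕ<n+toℕ : ∀ (u v : Fin n) → toℕ u < n + toℕ v
    toℕ<n+toℕ u v = <-≤-trans (toℕ<n u) (m≤m+n n (toℕ v))

  insideFirst-injective : Injective _≡_ _≡_ insideFirst
  insideFirst-injective {u} {v} eq with u ∈? I | v ∈? I
  ... | yes _ | yes _ = toℕ-injective eq
  ... | no _  | no _  = toℕ-injective (+-cancelˡ-≡ n _ _ eq)
  ... | yes _ | no _  = ⊥-elim (<⇒≢ (toℕ<n+toℕ u v) eq)
  ... | no _  | yes _ = ⊥-elim (<⇒≢ (toℕ<n+toℕ v u) (≡-sym eq))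

  insideFirst-< : ∀ {x w} → x ∈ I → w ∉ I → insideFirst x < insideFirst w
  insideFirst-< {x} {w} x∈I w∉I with x ∈? I | w ∈? I
  ... | yes _ | no _   = toℕ<n+toℕ x w
  ... | no x∉I | _     = ⊥-elim (x∉I x∈I)
  ... | _ | yes w∈I    = ⊥-elim (w∉I w∈I)

independent⇒sourceOrientation : ∀ {n} (G : Graph n) (I : Subset n) → IsIndependent G I →
  ∃[ D ] (IsOrientation G D × ∀ {d U} → IsDistDominating D d U → I ⊆ U)
independent⇒sourceOrientation G I I-ind =
  orientByRank , isOrientation (insideFirst-injective I) , λ dom x∈I → source∈dominating (source (below x∈I)) dom
  where
  open RankOrientation G (insideFirst I)
  below : ∀ {x w} → x ∈ I → adj G w x ≡ true → insideFirst I x < insideFirst I w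
  below {x} {w} x∈I e = insideFirst-< I x∈I λ w∈I → ≡false⇒≢true (I-ind w x w∈I x∈I) e

theorem3p3 : ∀ (n : ℕ) (G : Graph n) (d : ℕ) → 2 ≤ d →
    ∀ (a : ℕ) → IsIndependenceNumber G a → IsOrientedDomNumber G d a
theorem3p3 n G d 2≤d a ((I , I-ind , ∣I∣≡a) , α-max)
  with D₀ , D₀-orient , I⊆dominating ← independent⇒sourceOrientation G I I-ind
  with U₀ , U₀-dom , U₀-ind ← orientation-independentDominating G D₀-orient 2≤d
  = (D₀ , D₀-orient , (U₀ , U₀-dom , ≤-antisym (α-max U₀ U₀-ind) (a≤ U₀-dom)) , λ _ → a≤) , γ≤a
  where
  a≤ : ∀ {U} → IsDistDominating D₀ d U → a ≤ ∣ U ∣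
  a≤ {U} dom = subst (_≤ ∣ U ∣) ∣I∣≡a (p⊆q⇒∣p∣≤∣q∣ (I⊆dominating dom))

  γ≤a : ∀ D → IsOrientation G D → ∀ g → IsDomNumber D d g → g ≤ a
  γ≤a D o g (_ , g-min) with U , dom , ind ← orientation-independentDominating G o 2≤d =
    ≤-trans (g-min U dom) (α-max U ind)
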